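{- The set of sorting words of the permutations $\pi$ (of any positive size $n$) with $\mathrm{psb}(\pi)=12\cdots n$ is exactly the set $W$ of finite words over the alphabet $\{0,1,2\}$ that begin with $0$, end with $0$ or $2$, and contain no two adjacent letters $1$ followed immediately by $2$ (i.e. no factor $12$).
   Context: The algorithm PSB processes a permutation $\pi=\pi_1\cdots\pi_n$ from left to right with one pop stack $S$ (initially empty; PUSH puts an element on top, POP removes all elements appending them to the output from top to bottom) and an initially empty output: for $i=1,\dots,n$, if $S$ is empty or $\pi_i=\mathrm{TOP}(S)-1$ (where $\mathrm{TOP}(S)$ is the top element of $S$), push $\pi_i$; else if $\pi_i<\mathrm{TOP}(S)-1$, append $\pi_i$ directly to the output (BYPASS); otherwise pop $S$ and then push $\pi_i$. After all entries are processed, pop $S$. The output is $\mathrm{psb}(\pi)$. The sorting word of $\pi$ is the word $w_1\cdots w_n$ where $w_i=0$ if, when $\pi_i$ is processed, PSB performs PUSH only; $w_i=1$ if it performs BYPASS; and $w_i=2$ if it performs POP followed by PUSH. -}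

module Defs where

open import Data.Nat using (ℕ; zero; suc; _<_; _≟_; _<?_)
open import Data.List using (List; []; _∷_; _++_; _∷ʳ_; map; upTo)
open import Data.Product using (_×_; _,_; ∃; ∃-syntax; proj₁; proj₂)
open import Data.Sum using (_⊎_)
open import Relation.Nullary using (¬_; yes; no)
open import Relation.Binary.PropositionalEquality using (_≡_)

data Letter : Set where
  𝟎 𝟏 𝟐 : Letter

-- State of PSB: (stack with top at the head, output so far, sorting word so far)
record State : Set where
  constructor st
  field
    stack  : List ℕ
    output : List ℕ
    word   : List Letter

step : State → ℕ → State
step (st [] out w) x = st (x ∷ []) out (w ∷ʳ 𝟎)
step (st (t ∷ s) out w) x with suc x ≟ t
... | yes _ = st (x ∷ t ∷ s) out (w ∷ʳ 𝟎)
... | no _ with suc (suc x) Data.Nat.≤? t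
...   | yes _ = st (t ∷ s) (out ∷ʳ x) (w ∷ʳ 𝟏)                    -- x < TOP(S) - 1: BYPASS
...   | no _  = st (x ∷ []) (out ++ (t ∷ s)) (w ∷ʳ 𝟐)            -- otherwise: POP, then PUSH

run : State → List ℕ → State
run σ []       = σ
run σ (x ∷ xs) = run (step σ x) xs

final : List ℕ → State
final π = run (st [] [] []) π

psb : List ℕ → List ℕ
psb π = State.output (final π) ++ State.stack (final π)

sortingWord : List ℕ → List Letter
sortingWord π = State.word (final π)

iota : ℕ → List ℕ
iota n = map suc (upTo n)

InW : List Letter → Set
InW w = (∃[ u ] w ≡ 𝟎 ∷ u)
      × (∃[ u ] (w ≡ u ∷ʳ 𝟎 ⊎ w ≡ u ∷ʳ 𝟐))
      × ¬ (∃[ u ] ∃[ v ] w ≡ u ++ (𝟏 ∷ 𝟐 ∷ v))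

module Submission where

-- A BYPASS of x leaves x at the end of the output with a stack top t ≥ x + 2 above it.  If
-- the next action is a POP, or the input ends, the stack is flushed right after x, so t
-- follows x in psb π and psb π is not 1 2 ⋯ n; hence a 𝟏 is followed by 𝟎 or 𝟏, while the
-- first letter is always a PUSH.  Conversely a word of W is realised block by block: inside a
-- maximal block of 𝟎s and 𝟏s each 𝟎 pushes the value just below the stack top and each 𝟏
-- bypasses the next value of the output, and each 𝟐 pops and pushes a value exactly large
-- enough to leave room for the following block.

open import Defs
open import Data.Bool using (Bool; true; false; T)
open import Data.Empty using (⊥-elim)
open import Data.List using (List; []; _∷_; [_]; _++_; _∷ʳ_; map; upTo; applyUpTo; iterate; last)
open import Data.List.Properties using (++-assoc; ++-identityʳ; map-upTo)
open import Data.List.Relation.Unary.Linked using (Linked; head; tail)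
open import Data.List.Relation.Unary.Linked.Properties using (applyUpTo⁺₂)
open import Data.List.Relation.Binary.Permutation.Propositional
  using (_↭_; ↭-refl; ↭-sym; ↭-trans; ↭-reflexive; module PermutationReasoning)
open import Data.List.Relation.Binary.Permutation.Propositional.Properties using (shift; ++⁺ˡ; ∷↭∷ʳ)
open import Data.Maybe using (just)
open import Data.Nat using (ℕ; zero; suc; _+_; _≤_; _≥_; z≤n; s≤s; _≟_; _≤?_)
open import Data.Nat.Properties
  using (<-cmp; <-irrefl; <⇒≤; ≤⇒≯; ≤-trans; m≤m+n; m≤n+m; +-suc; +-comm; +-identityʳ; +-monoˡ-≤)
open import Data.Product using (_×_; _,_; ∃-syntax)
open import Data.Sum using (_⊎_; inj₁; inj₂)
open import Function.Bundles using (_⇔_; mk⇔; Equivalence)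
open import Relation.Binary.Definitions using (tri<; tri≈; tri>)
open import Relation.Nullary using (¬_; yes; no; contradiction)
open import Relation.Binary.PropositionalEquality
  using (_≡_; _≢_; refl; sym; trans; cong; cong₂; subst; module ≡-Reasoning)

open State

segment : ℕ → ℕ → List ℕ
segment = iterate suc

segment-++ : ∀ c a b → segment c a ++ segment (c + a) b ≡ segment c (a + b)
segment-++ c zero    b = cong (λ d → segment d b) (+-identityʳ c)
segment-++ c (suc a) b = cong (c ∷_) (begin
  segment (suc c) a ++ segment (c + suc a) b ≡⟨ cong (λ d → segment (suc c) a ++ segment d b) (+-suc c a) ⟩
  segment (suc c) a ++ segment (suc c + a) b ≡⟨ segment-++ (suc c) a b ⟩
  segment (suc c) (a + b)                    ∎)
  where open ≡-Reasoning

segment-∷ʳ : ∀ c n → segment c n ∷ʳ (c + n) ≡ segment c (suc n)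
segment-∷ʳ c n = trans (segment-++ c n 1) (cong (segment c) (+-comm n 1))

map-segment : ∀ c n → map suc (segment c n) ≡ segment (suc c) n
map-segment c zero    = refl
map-segment c (suc n) = cong (suc c ∷_) (map-segment (suc c) n)

upTo≡segment : ∀ n → upTo n ≡ segment 0 n
upTo≡segment zero    = refl
upTo≡segment (suc n) = cong (0 ∷_) (begin
  applyUpTo suc n         ≡⟨ map-upTo suc n ⟨
  map suc (upTo n)        ≡⟨ cong (map suc) (upTo≡segment n) ⟩
  map suc (segment 0 n)   ≡⟨ map-segment 0 n ⟩
  segment 1 n             ∎)
  where open ≡-Reasoning

iota≡segment : ∀ n → iota n ≡ segment 1 n
iota≡segment n = trans (cong (map suc) (upTo≡segment n)) (map-segment 0 n)

Consecutive : List ℕ → Set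
Consecutive = Linked (λ x y → y ≡ suc x)

iota-consecutive : ∀ n → Consecutive (iota n)
iota-consecutive n = subst Consecutive (sym (map-upTo suc n)) (applyUpTo⁺₂ suc n (λ _ → refl))

consecutive-infix : ∀ o {x y} r → Consecutive (o ++ x ∷ y ∷ r) → y ≡ suc x
consecutive-infix []      r c = head c
consecutive-infix (_ ∷ o) r c = consecutive-infix o r (tail c)

step-push : ∀ {t s o w x} → suc x ≡ t → step (st (t ∷ s) o w) x ≡ st (x ∷ t ∷ s) o (w ∷ʳ 𝟎)
step-push {t} {x = x} x+1≡t with suc x ≟ t
... | yes _     = refl
... | no x+1≢t = contradiction x+1≡t x+1≢t

step-bypass : ∀ {t s o w x} → suc (suc x) ≤ t → step (st (t ∷ s) o w) x ≡ st (t ∷ s) (o ∷ʳ x) (w ∷ʳ 𝟏)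
step-bypass {t} {x = x} x+2≤t with suc x ≟ t
... | yes refl = contradiction x+2≤t (<-irrefl refl)
... | no _ with suc (suc x) ≤? t
...   | yes _    = refl
...   | no x+2≰t = contradiction x+2≤t x+2≰t

step-pop : ∀ {t s o w x} → t ≤ x → step (st (t ∷ s) o w) x ≡ st (x ∷ []) (o ++ t ∷ s) (w ∷ʳ 𝟐)
step-pop {t} {x = x} t≤x with suc x ≟ t
... | yes refl = contradiction t≤x (<-irrefl refl)
... | no _ with suc (suc x) ≤? t
...   | yes x+2≤t = contradiction (<⇒≤ x+2≤t) (≤⇒≯ t≤x)
...   | no _      = refl

data StepView (σ : State) (x : ℕ) : Set where
  push   : step σ x ≡ st (x ∷ stack σ) (output σ) (word σ ∷ʳ 𝟎) → StepView σ x
  bypass : ∀ {t s} → stack σ ≡ t ∷ s → suc (suc x) ≤ t →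
           step σ x ≡ st (stack σ) (output σ ∷ʳ x) (word σ ∷ʳ 𝟏) → StepView σ x
  pop    : step σ x ≡ st (x ∷ []) (output σ ++ stack σ) (word σ ∷ʳ 𝟐) → StepView σ x

stepView : ∀ σ x → StepView σ x
stepView (st []      o w) x = push refl
stepView (st (t ∷ s) o w) x with <-cmp (suc x) t
... | tri< x+2≤t _ _       = bypass refl x+2≤t (step-bypass x+2≤t)
... | tri≈ _ x+1≡t _       = push (step-push x+1≡t)
... | tri> _ _ (s≤s t≤x)   = pop (step-pop t≤x)

flush : State → List ℕ
flush σ = output σ ++ stack σ

flush-step-↭ : ∀ σ x → flush (step σ x) ↭ x ∷ flush σ
flush-step-↭ σ@(st s o w) x with stepView σ x
... | push e       rewrite e = shift x o s
... | bypass _ _ e rewrite e = ↭-trans (↭-reflexive (++-assoc o [ x ] s)) (shift x o s)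
... | pop e        rewrite e = ↭-sym (∷↭∷ʳ x (o ++ s))

flush-run-↭ : ∀ xs σ → xs ++ flush σ ↭ flush (run σ xs)
flush-run-↭ []       σ = ↭-refl
flush-run-↭ (x ∷ xs) σ = begin
  x ∷ xs ++ flush σ       ↭⟨ shift x xs (flush σ) ⟨
  xs ++ x ∷ flush σ       ↭⟨ ++⁺ˡ xs (flush-step-↭ σ x) ⟨
  xs ++ flush (step σ x)  ↭⟨ flush-run-↭ xs (step σ x) ⟩
  flush (run σ (x ∷ xs))  ∎
  where open PermutationReasoning

psb-↭ : ∀ π → π ↭ psb π
psb-↭ π = ↭-trans (↭-reflexive (sym (++-identityʳ π))) (flush-run-↭ π (st [] [] []))

step-output : ∀ σ x → ∃[ z ] output (step σ x) ≡ output σ ++ z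
step-output σ@(st s o w) x with stepView σ x
... | push e       rewrite e = [] , sym (++-identityʳ o)
... | bypass _ _ e rewrite e = [ x ] , refl
... | pop e        rewrite e = s , refl

output-prefix : ∀ xs σ → ∃[ z ] flush (run σ xs) ≡ output σ ++ z
output-prefix []       σ = stack σ , refl
output-prefix (x ∷ xs) σ with step-output σ x | output-prefix xs (step σ x)
... | z , out≡ | z′ , flush≡ = z ++ z′ , (begin
  flush (run (step σ x) xs)    ≡⟨ flush≡ ⟩
  output (step σ x) ++ z′      ≡⟨ cong (_++ z′) out≡ ⟩
  (output σ ++ z) ++ z′        ≡⟨ ++-assoc (output σ) z z′ ⟩
  output σ ++ z ++ z′          ∎)
  where open ≡-Reasoning

data Bypassed : State → Set where
  bypassed : ∀ {t s o x w} → suc (suc x) ≤ t → Bypassed (st (t ∷ s) (o ∷ʳ x) w)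

bypassed-inconsecutive : ∀ {σ} → Bypassed σ → ∀ z → ¬ Consecutive (flush σ ++ z)
bypassed-inconsecutive (bypassed {t} {s} {o} {x} x+2≤t) z c =
  <-irrefl refl (subst (suc (suc x) ≤_) t≡x+1 x+2≤t)
  where
  reassoc : ((o ∷ʳ x) ++ t ∷ s) ++ z ≡ o ++ x ∷ t ∷ s ++ z
  reassoc = trans (++-assoc (o ∷ʳ x) (t ∷ s) z) (++-assoc o [ x ] (t ∷ s ++ z))
  t≡x+1 : t ≡ suc x
  t≡x+1 = consecutive-infix o (s ++ z) (subst Consecutive reassoc c)

-- Admissible b r: r is a possible continuation, within a word of W, of a prefix whose last
-- letter is 𝟏 iff b holds.
data Admissible : Bool → List Letter → Set where
  []   : Admissible false []
  𝟎∷_ : ∀ {b r} → Admissible false r → Admissible b (𝟎 ∷ r)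
  𝟏∷_ : ∀ {b r} → Admissible true r → Admissible b (𝟏 ∷ r)
  𝟐∷_ : ∀ {r} → Admissible false r → Admissible false (𝟐 ∷ r)

admissible-∷ : ∀ {v w a b b′} → (∀ {r} → Admissible b′ r → Admissible b (a ∷ r)) →
               ∃[ r ] v ≡ (w ∷ʳ a) ++ r × Admissible b′ r → ∃[ r ] v ≡ w ++ r × Admissible b r
admissible-∷ {w = w} {a} a∷_ (r , v≡ , adm) = a ∷ r , trans v≡ (++-assoc w [ a ] r) , a∷ adm

run-admissible : ∀ {b} xs σ → (T b → Bypassed σ) → Consecutive (flush (run σ xs)) →
                 ∃[ r ] word (run σ xs) ≡ word σ ++ r × Admissible b r
run-admissible {false} [] σ _ _ = [] , sym (++-identityʳ (word σ)) , []
run-admissible {true}  [] σ byp c =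
  ⊥-elim (bypassed-inconsecutive (byp _) [] (subst Consecutive (sym (++-identityʳ (flush σ))) c))
run-admissible (x ∷ xs) σ@(st s o w) byp c with stepView σ x
... | push e rewrite e = admissible-∷ 𝟎∷_ (run-admissible xs _ (λ ()) c)
... | bypass refl x+2≤t e rewrite e =
  admissible-∷ 𝟏∷_ (run-admissible xs _ (λ _ → bypassed x+2≤t) c)
run-admissible {false} (x ∷ xs) σ@(st s o w) byp c | pop e rewrite e =
  admissible-∷ 𝟐∷_ (run-admissible xs _ (λ ()) c)
run-admissible {true} (x ∷ xs) σ@(st s o w) byp c | pop e with output-prefix xs (step σ x)
... | z , flush≡ rewrite e = ⊥-elim (bypassed-inconsecutive (byp _) z (subst Consecutive flush≡ c))

sortingWord-admissible : ∀ y ys → Consecutive (psb (y ∷ ys)) →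
                         ∃[ r ] sortingWord (y ∷ ys) ≡ 𝟎 ∷ r × Admissible false r
sortingWord-admissible y ys = run-admissible ys (st [ y ] [] [ 𝟎 ]) (λ ())

lengthUntil𝟐 : List Letter → ℕ
lengthUntil𝟐 (𝟎 ∷ r) = suc (lengthUntil𝟐 r)
lengthUntil𝟐 (𝟏 ∷ r) = suc (lengthUntil𝟐 r)
lengthUntil𝟐 _       = 0

lengthUntil𝟐-pos : ∀ {r} → Admissible true r → 1 ≤ lengthUntil𝟐 r
lengthUntil𝟐-pos (𝟎∷ _) = s≤s z≤n
lengthUntil𝟐-pos (𝟏∷ _) = s≤s z≤n

Realisable : State → List Letter → Set
Realisable σ r = ∃[ xs ] word (run σ xs) ≡ word σ ++ r × ∃[ n ] flush (run σ xs) ≡ segment 1 (suc n)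

realisable-∷ : ∀ {σ s o a r} x → step σ x ≡ st s o (word σ ∷ʳ a) →
               Realisable (st s o (word σ ∷ʳ a)) r → Realisable σ (a ∷ r)
realisable-∷ {σ} {a = a} {r} x e (xs , word≡ , n , flush≡) =
  x ∷ xs , trans (cong (λ τ → word (run τ xs)) e) (trans word≡ (++-assoc (word σ) [ a ] r)) ,
  n , trans (cong (λ τ → flush (run τ xs)) e) flush≡

-- Invariant: output 1 ⋯ m and stack c ⋯ c+L with c = ℓ + m + 1, where ℓ counts the letters
-- before the next 𝟐.  A 𝟎 pushes c − 1 and a 𝟏 bypasses m + 1, so the values m+1 ⋯ c−1 are
-- used up exactly when the block ends, and then the stack continues the output.
realise : ∀ {b} r m L w → Admissible b r →
          Realisable (st (segment (suc (lengthUntil𝟐 r + m)) (suc L)) (segment 1 m) w) r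
realise [] m L w [] =
  [] , sym (++-identityʳ w) , m + L , trans (segment-++ 1 m (suc L)) (cong (segment 1) (+-suc m L))
realise (𝟎 ∷ r) m L w (𝟎∷ adm) =
  realisable-∷ (suc (lengthUntil𝟐 r + m)) (step-push refl) (realise r m (suc L) (w ∷ʳ 𝟎) adm)
realise (𝟏 ∷ r) m L w (𝟏∷ adm) =
  realisable-∷ (suc m) (trans (step-bypass m+3≤c) state≡) (realise r (suc m) L (w ∷ʳ 𝟏) adm)
  where
  m+3≤c : suc (suc (suc m)) ≤ suc (suc (lengthUntil𝟐 r + m))
  m+3≤c = s≤s (s≤s (+-monoˡ-≤ m (lengthUntil𝟐-pos adm)))
  state≡ : st (segment (suc (suc (lengthUntil𝟐 r + m))) (suc L)) (segment 1 m ∷ʳ suc m) (w ∷ʳ 𝟏)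
         ≡ st (segment (suc (lengthUntil𝟐 r + suc m)) (suc L)) (segment 1 (suc m)) (w ∷ʳ 𝟏)
  state≡ = cong₂ (λ c o → st (segment c (suc L)) o (w ∷ʳ 𝟏))
                 (cong suc (sym (+-suc (lengthUntil𝟐 r) m))) (segment-∷ʳ 1 m)
realise (𝟐 ∷ r) m L w (𝟐∷ adm) =
  realisable-∷ x (trans (step-pop m+1≤x) state≡) (realise r (m + suc L) 0 (w ∷ʳ 𝟐) adm)
  where
  x = suc (lengthUntil𝟐 r + (m + suc L))
  m+1≤x : suc m ≤ x
  m+1≤x = s≤s (≤-trans (m≤m+n m (suc L)) (m≤n+m (m + suc L) (lengthUntil𝟐 r)))
  state≡ : st [ x ] (segment 1 m ++ segment (suc m) (suc L)) (w ∷ʳ 𝟐)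
         ≡ st [ x ] (segment 1 (m + suc L)) (w ∷ʳ 𝟐)
  state≡ = cong (λ o → st [ x ] o (w ∷ʳ 𝟐)) (segment-++ 1 m (suc L))

realise-word : ∀ {r} → Admissible false r → ∃[ n ] ∃[ π ] psb π ≡ iota (suc n) × sortingWord π ≡ 𝟎 ∷ r
realise-word {r} adm with realise r 0 0 [ 𝟎 ] adm
... | xs , word≡ , n , flush≡ =
  n , suc (lengthUntil𝟐 r + 0) ∷ xs , trans flush≡ (sym (iota≡segment (suc n))) , word≡

isBypass : Letter → Bool
isBypass 𝟏 = true
isBypass _ = false

admissible-tail : ∀ {b a r} → Admissible b (a ∷ r) → Admissible (isBypass a) r
admissible-tail (𝟎∷ adm) = adm
admissible-tail (𝟏∷ adm) = adm
admissible-tail (𝟐∷ adm) = adm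

admissible-no𝟏𝟐 : ∀ {b} u v → ¬ Admissible b (u ++ 𝟏 ∷ 𝟐 ∷ v)
admissible-no𝟏𝟐 []      v (𝟏∷ ())
admissible-no𝟏𝟐 (_ ∷ u) v adm = admissible-no𝟏𝟐 u v (admissible-tail adm)

EndsIn𝟎or𝟐 : List Letter → Set
EndsIn𝟎or𝟐 w = ∃[ u ] (w ≡ u ∷ʳ 𝟎 ⊎ w ≡ u ∷ʳ 𝟐)

∷-endsIn𝟎or𝟐 : ∀ a {w} → EndsIn𝟎or𝟐 w → EndsIn𝟎or𝟐 (a ∷ w)
∷-endsIn𝟎or𝟐 a (u , inj₁ w≡) = a ∷ u , inj₁ (cong (a ∷_) w≡)
∷-endsIn𝟎or𝟐 a (u , inj₂ w≡) = a ∷ u , inj₂ (cong (a ∷_) w≡)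

admissible-endsIn𝟎or𝟐 : ∀ {b} a r → Admissible b (a ∷ r) → EndsIn𝟎or𝟐 (a ∷ r)
admissible-endsIn𝟎or𝟐 𝟎 []      _        = [] , inj₁ refl
admissible-endsIn𝟎or𝟐 𝟐 []      _        = [] , inj₂ refl
admissible-endsIn𝟎or𝟐 𝟏 []      (𝟏∷ ())
admissible-endsIn𝟎or𝟐 a (x ∷ r) adm      = ∷-endsIn𝟎or𝟐 a (admissible-endsIn𝟎or𝟐 x r (admissible-tail adm))

last-∷ʳ : ∀ {A : Set} (u : List A) a → last (u ∷ʳ a) ≡ just a
last-∷ʳ []          a = refl
last-∷ʳ (_ ∷ [])    a = refl
last-∷ʳ (_ ∷ y ∷ u) a = last-∷ʳ (y ∷ u) a

endsIn𝟎or𝟐⇒last≢𝟏 : ∀ {w} → EndsIn𝟎or𝟐 w → last w ≢ just 𝟏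
endsIn𝟎or𝟐⇒last≢𝟏 (u , inj₁ refl) last≡ with () ← trans (sym (last-∷ʳ u 𝟎)) last≡
endsIn𝟎or𝟐⇒last≢𝟏 (u , inj₂ refl) last≡ with () ← trans (sym (last-∷ʳ u 𝟐)) last≡

NoFactor𝟏𝟐 : List Letter → Set
NoFactor𝟏𝟐 w = ¬ (∃[ u ] ∃[ v ] w ≡ u ++ 𝟏 ∷ 𝟐 ∷ v)

noFactor𝟏𝟐-tail : ∀ {a r} → NoFactor𝟏𝟐 (a ∷ r) → NoFactor𝟏𝟐 r
noFactor𝟏𝟐-tail {a} no𝟏𝟐 (u , v , r≡) = no𝟏𝟐 (a ∷ u , v , cong (a ∷_) r≡)

to-admissible : ∀ a r → last (a ∷ r) ≢ just 𝟏 → NoFactor𝟏𝟐 (a ∷ r) → Admissible (isBypass a) r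
to-admissible 𝟎 []      _       _    = []
to-admissible 𝟐 []      _       _    = []
to-admissible 𝟏 []      last≢𝟏 _    = contradiction refl last≢𝟏
to-admissible _ (𝟎 ∷ r) last≢𝟏 no𝟏𝟐 = 𝟎∷ to-admissible 𝟎 r last≢𝟏 (noFactor𝟏𝟐-tail no𝟏𝟐)
to-admissible _ (𝟏 ∷ r) last≢𝟏 no𝟏𝟐 = 𝟏∷ to-admissible 𝟏 r last≢𝟏 (noFactor𝟏𝟐-tail no𝟏𝟐)
to-admissible 𝟎 (𝟐 ∷ r) last≢𝟏 no𝟏𝟐 = 𝟐∷ to-admissible 𝟐 r last≢𝟏 (noFactor𝟏𝟐-tail no𝟏𝟐)
to-admissible 𝟐 (𝟐 ∷ r) last≢𝟏 no𝟏𝟐 = 𝟐∷ to-admissible 𝟐 r last≢𝟏 (noFactor𝟏𝟐-tail no𝟏𝟐)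
to-admissible 𝟏 (𝟐 ∷ r) _       no𝟏𝟐 = contradiction ([] , r , refl) no𝟏𝟐

InW⇔admissible : ∀ {w} → InW w ⇔ (∃[ r ] w ≡ 𝟎 ∷ r × Admissible false r)
InW⇔admissible = mk⇔
  (λ { ((r , refl) , ends , no𝟏𝟐) → r , refl , to-admissible 𝟎 r (endsIn𝟎or𝟐⇒last≢𝟏 ends) no𝟏𝟐 })
  (λ { (r , refl , adm) →
         (r , refl) ,
         admissible-endsIn𝟎or𝟐 {false} 𝟎 r (𝟎∷ adm) ,
         (λ (u , v , w≡) → admissible-no𝟏𝟐 u v (subst (Admissible false) w≡ (𝟎∷ adm))) })

mainTheorem3 : (w : List Letter) →
    (∃[ n ] ∃[ π ] (n ≥ 1 × π ↭ iota n × psb π ≡ iota n × sortingWord π ≡ w)) ⇔ InW w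
mainTheorem3 w = mk⇔ sorted⇒InW InW⇒sorted
  where
  sorted⇒InW : (∃[ n ] ∃[ π ] (n ≥ 1 × π ↭ iota n × psb π ≡ iota n × sortingWord π ≡ w)) → InW w
  sorted⇒InW (suc n , []     , _ , _ , ()   , _)
  sorted⇒InW (n     , y ∷ ys , _ , _ , psb≡ , refl) =
    Equivalence.from InW⇔admissible
      (sortingWord-admissible y ys (subst Consecutive (sym psb≡) (iota-consecutive n)))

  InW⇒sorted : InW w → ∃[ n ] ∃[ π ] (n ≥ 1 × π ↭ iota n × psb π ≡ iota n × sortingWord π ≡ w)
  InW⇒sorted inW with Equivalence.to InW⇔admissible inW
  ... | r , refl , adm with realise-word adm
  ...   | n , π , psb≡ , word≡ = suc n , π , s≤s z≤n , ↭-trans (psb-↭ π) (↭-reflexive psb≡) , psb≡ , word≡
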